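{- Let $a=(a_1,\dots,a_k,0,\dots,0,a_{k+m+1})$, with $m\ge 0$ zeros, where $a_1\ge\dots\ge a_k$ are positive integers and $a_{k+m+1}$ is a nonnegative integer with $a_{k+m+1}\le a_k$. Then $\kappa_a=\mathfrak{F}_a$.
   Context: A weak composition $a=(a_1,\dots,a_\ell)$ of length $\ell$ is a finite sequence of nonnegative integers. For weak compositions $a,b$ of length $\ell$, $b$ dominates $a$ if $b_1+\dots+b_i\ge a_1+\dots+a_i$ for all $i$; $\mathrm{flat}(a)$ is obtained by deleting the zeros of $a$; a strong composition $\beta$ refines a strong composition $\gamma$ if $\gamma$ is obtained by summing consecutive blocks of parts of $\beta$. The fundamental slide polynomial is $\mathfrak{F}_a=\sum x^b$ over weak compositions $b$ of length $\ell$ dominating $a$ with $\mathrm{flat}(b)$ refining $\mathrm{flat}(a)$, where $x^b=x_1^{b_1}\cdots x_\ell^{b_\ell}$. A diagram is a finite set of cells $(r,c)$ (row $r$ from the bottom, column $c$ from the left). A Kohnert tableau of content $a$ is a diagram filled with positive integers, exactly $a_i$ cells containing $i$ for each $i$, such that: (i) for each $i$ there is exactly one $i$ in each of the columns $1,\dots,a_i$; (ii) every entry in row $r$ is at least $r$; (iii) for each $i$, the cells containing $i$ weakly descend from left to right; (iv) if $i<j$ appear in the same column with $i$ above $j$, then there is an $i$ in the column immediately to the right of the cell containing that $j$, in a row strictly above it. The key polynomial is $\kappa_a=\sum_T x^{\mathrm{wt}(T)}$ over all Kohnert tableaux $T$ of content $a$, where $\mathrm{wt}(T)$ has $r$-th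 part equal to the number of cells in row $r$ of $T$. -}

module Defs where

open import Data.Nat using (ℕ; zero; suc; _+_; _≤_; _<_; _≡ᵇ_)
open import Data.Bool using (if_then_else_)
open import Data.List using (List; []; _∷_; _++_; length; map; upTo; take)
open import Data.Nat.ListAction using (sum)
open import Data.Nat.Properties using (_≟_)
open import Relation.Nullary using (¬_)
open import Relation.Binary.PropositionalEquality using (_≡_; _≢_)
open import Data.Product using (_×_; ∃)

infixl 9 _!_[_]
_!_[_] : {A : Set} → List A → ℕ → A → A
[] ! _ [ d ] = d
(x ∷ xs) ! zero [ d ] = x
(x ∷ xs) ! suc n [ d ] = xs ! n [ d ]

_!ℕ_ : List ℕ → ℕ → ℕ
xs !ℕ n = xs ! n [ 0 ]

flat : List ℕ → List ℕ
flat [] = []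
flat (zero ∷ xs) = flat xs
flat (suc x ∷ xs) = suc x ∷ flat xs

Dominates : List ℕ → List ℕ → Set
Dominates b a = ∀ i → i ≤ length a → sum (take i a) ≤ sum (take i b)

data Refines : List ℕ → List ℕ → Set where
  ref[] : Refines [] []
  ref∷  : ∀ β₁ β₂ γ → β₁ ≢ [] → Refines β₂ γ → Refines (β₁ ++ β₂) (sum β₁ ∷ γ)

-- x^b occurs (with coefficient 1) in the fundamental slide polynomial 𝔉_a
-- iff b is a weak composition of the same length as a, dominating a,
-- with flat(b) refining flat(a).
InSlide : List ℕ → List ℕ → Set
InSlide a b = length b ≡ length a × Dominates b a × Refines (flat b) (flat a)

-- Kohnert tableaux
-- By condition (i), a Kohnert tableau of content a (length ℓ) is determined
-- by the row of the unique cell containing entry i in column c, for each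
-- entry i ∈ {1..ℓ} and column c ∈ {1..a_i}.  We encode a tableau as
-- T : List (List ℕ) with  T ! (i-1) ! (c-1) = row of the i in column c.
-- Below, entries and columns are quantified 0-indexed: index i stands for
-- entry i+1, index c for column c+1.  Rows are stored 1-indexed (row 1 is
-- the bottom row).

rowOf : List (List ℕ) → ℕ → ℕ → ℕ
rowOf T i c = (T ! i [ [] ]) !ℕ c

IsCell : List ℕ → ℕ → ℕ → Set
IsCell a i c = i < length a × c < a !ℕ i

rowCount : List ℕ → List (List ℕ) → ℕ → ℕ
rowCount a T r =
  sum (map (λ i → sum (map (λ c → if rowOf T i c ≡ᵇ r then 1 else 0)
                           (upTo (a !ℕ i))))
           (upTo (length a)))

record IsKohnertTableau (a : List ℕ) (T : List (List ℕ)) : Set where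
  field
    shapeLen  : length T ≡ length a
    shapeRow  : ∀ i → i < length a → length (T ! i [ [] ]) ≡ a !ℕ i
    rowPos    : ∀ i c → IsCell a i c → 1 ≤ rowOf T i c
    -- a diagram is a set of cells: distinct entries occupy distinct cells
    distinct  : ∀ i j c → IsCell a i c → IsCell a j c → i ≢ j →
                rowOf T i c ≢ rowOf T j c
    -- (ii) every entry in row r is at least r
    condII    : ∀ i c → IsCell a i c → rowOf T i c ≤ suc i
    condIII   : ∀ i c c' → IsCell a i c' → c < c' → rowOf T i c' ≤ rowOf T i c
    -- (iv) if i < j in the same column with i above j, then there is an i
    --      in the next column, strictly above the cell containing j
    condIV    : ∀ i j c → IsCell a i c → IsCell a j c → i < j →
                rowOf T j c < rowOf T i c →
                suc c < a !ℕ i × rowOf T j c < rowOf T i (suc c)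

record KohnertOfWeight (a b : List ℕ) (T : List (List ℕ)) : Set where
  field
    isKT    : IsKohnertTableau a T
    wtLen   : length b ≡ length a
    wtRows  : ∀ r → r < length a → b !ℕ r ≡ rowCount a T (suc r)

AllPos : List ℕ → Set
AllPos xs = ∀ i → i < length xs → 1 ≤ xs !ℕ i

WeaklyDecreasing : List ℕ → Set
WeaklyDecreasing xs = ∀ i j → i ≤ j → j < length xs → xs !ℕ j ≤ xs !ℕ i

-- The positive prefix a₁ ≥ … ≥ a_k is rigid on both sides.  Domination and refinement force every
-- weight b of 𝔉_a to begin with a₁, …, a_k, followed by an arbitrary weak composition of a_{k+m+1}
-- into m+1 parts.  In a Kohnert tableau of content a, condition (ii) and the distinctness of cells
-- force entry i ≤ k to fill row i, by induction on i: since a is decreasing on its prefix, the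
-- earlier entries occupy rows 1, …, i-1 of every column of entry i.  As a_{k+m+1} ≤ a_k, the cells
-- of the last entry then lie in rows k+1, …, k+m+1, and by (iii) they descend weakly; so the
-- tableau is determined by its row counts in those rows, which again form an arbitrary weak
-- composition of a_{k+m+1} into m+1 parts, and every such choice satisfies (i)–(iv).

module Submission where

open import Defs
open import Data.Nat using (ℕ; zero; suc; _+_; _∸_; _≤_; _<_; _≥_; _≡ᵇ_; z≤n; s≤s; _≤?_; _<?_)
open import Data.Nat.Properties
open import Data.Nat.Induction using (<-rec)
open import Data.Nat.ListAction using (sum)
open import Data.Nat.ListAction.Properties using (sum-++)
open import Data.Bool using (if_then_else_)
open import Data.List using (List; []; _∷_; _++_; length; map; upTo; applyUpTo; take; replicate)
open import Data.List.Properties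
  using (length-++; length-replicate; length-map; map-++; map-replicate; take-all; ++-identityʳ; ++-cancelˡ)
open import Data.List.Relation.Unary.All as All using (All; []; _∷_)
open import Data.List.Relation.Unary.All.Properties using ()
  renaming (++⁺ to All-++⁺; ++⁻ˡ to All-++⁻ˡ; replicate⁺ to All-replicate⁺)
open import Data.List.Relation.Unary.AllPairs using (AllPairs; []; _∷_)
import Data.List.Relation.Unary.AllPairs.Properties as AllPairs
open import Data.Product using (_×_; _,_; proj₁; proj₂; ∃; ∃-syntax)
open import Data.Sum using (_⊎_; inj₁; inj₂)
open import Data.Empty using (⊥-elim)
open import Function using (_∘_; id)
open import Function.Bundles using (_⇔_; mk⇔)
open import Relation.Nullary using (¬_; Dec; yes; no)
open import Relation.Nullary.Decidable using (_×-dec_)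
open import Relation.Binary.PropositionalEquality
open import Relation.Binary.Definitions using (tri<; tri≈; tri>)
open ≡-Reasoning

!-++ˡ : ∀ {A : Set} (xs ys : List A) {i} {d : A} → i < length xs → (xs ++ ys) ! i [ d ] ≡ xs ! i [ d ]
!-++ˡ (x ∷ xs) ys {zero}  _         = refl
!-++ˡ (x ∷ xs) ys {suc i} (s≤s i<n) = !-++ˡ xs ys i<n

!-++ʳ : ∀ {A : Set} (xs ys : List A) {n j} {d : A} → length xs ≡ n → (xs ++ ys) ! (n + j) [ d ] ≡ ys ! j [ d ]
!-++ʳ []       ys refl = refl
!-++ʳ (x ∷ xs) ys refl = !-++ʳ xs ys refl

!-replicate : ∀ {A : Set} n (x : A) {i} {d : A} → i < n → replicate n x ! i [ d ] ≡ x
!-replicate (suc n) x {zero}  _         = refl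
!-replicate (suc n) x {suc i} (s≤s i<n) = !-replicate n x i<n

!-replicate-++ : ∀ {A : Set} m (x : A) ys {j} {d : A} → j < m → (replicate m x ++ ys) ! j [ d ] ≡ x
!-replicate-++ (suc m) x ys {zero}  _         = refl
!-replicate-++ (suc m) x ys {suc j} (s≤s j<m) = !-replicate-++ m x ys j<m

!-replicate-++-end : ∀ {A : Set} m (x : A) ys {d : A} → (replicate m x ++ ys) ! m [ d ] ≡ ys ! 0 [ d ]
!-replicate-++-end zero    x ys = refl
!-replicate-++-end (suc m) x ys = !-replicate-++-end m x ys

!-map : ∀ {A B : Set} (f : A → B) xs i {d : A} → map f xs ! i [ f d ] ≡ f (xs ! i [ d ])
!-map f []       i       = refl
!-map f (x ∷ xs) zero    = refl
!-map f (x ∷ xs) (suc i) = !-map f xs i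

!-beyond : ∀ {A : Set} (xs : List A) {i} {d : A} → length xs ≤ i → xs ! i [ d ] ≡ d
!-beyond []       _               = refl
!-beyond (x ∷ xs) {suc i} (s≤s ℓ≤i) = !-beyond xs ℓ≤i

!-ext : ∀ {A : Set} {d : A} (xs ys : List A) → length xs ≡ length ys →
        (∀ i → i < length xs → xs ! i [ d ] ≡ ys ! i [ d ]) → xs ≡ ys
!-ext []       []       _   _    = refl
!-ext (x ∷ xs) (y ∷ ys) len same =
  cong₂ _∷_ (same 0 (s≤s z≤n)) (!-ext xs ys (suc-injective len) (λ i i< → same (suc i) (s≤s i<)))

length≡0⇒≡[] : ∀ {A : Set} {xs : List A} → length xs ≡ 0 → xs ≡ []
length≡0⇒≡[] {xs = []} _ = refl

All⇒! : ∀ {P : ℕ → Set} {xs} → All P xs → ∀ {i} → i < length xs → P (xs !ℕ i)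
All⇒! (px ∷ _)   {zero}  _         = px
All⇒! (_  ∷ pxs) {suc i} (s≤s i<n) = All⇒! pxs i<n

!⇒All : ∀ {P : ℕ → Set} xs → (∀ i → i < length xs → P (xs !ℕ i)) → All P xs
!⇒All []       _  = []
!⇒All (x ∷ xs) px = px 0 (s≤s z≤n) ∷ !⇒All xs (λ i i< → px (suc i) (s≤s i<))

Between : ℕ → ℕ → ℕ → Set
Between lo n v = lo ≤ v × v < lo + n

between? : ∀ lo n v → Dec (Between lo n v)
between? lo n v = lo ≤? v ×-dec v <? lo + n

Between⇒offset : ∀ {lo n v} → Between lo n v → ∃[ j ] j < n × v ≡ lo + j
Between⇒offset {lo} {n} {v} (lo≤v , v<) =
  v ∸ lo , +-cancelˡ-< lo _ _ (subst (_< lo + n) (sym v≡) v<) , sym v≡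
  where
  v≡ : lo + (v ∸ lo) ≡ v
  v≡ = m+[n∸m]≡n lo≤v

index-split : ∀ lo {n v} → v < lo + n → v < lo ⊎ ∃[ j ] j < n × v ≡ lo + j
index-split lo {n} {v} v< with v <? lo
... | yes v<lo = inj₁ v<lo
... | no  v≮lo = inj₂ (Between⇒offset (≮⇒≥ v≮lo , v<))

avoiding⇒> : ∀ n {v} → 1 ≤ v → (∀ {j} → j < n → v ≢ suc j) → n < v
avoiding⇒> zero    1≤v _      = 1≤v
avoiding⇒> (suc n) 1≤v avoids =
  ≤∧≢⇒< (avoiding⇒> n 1≤v (avoids ∘ m<n⇒m<1+n)) (λ 1+n≡v → avoids ≤-refl (sym 1+n≡v))

sumBelow : ℕ → (ℕ → ℕ) → ℕ
sumBelow zero    f = 0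
sumBelow (suc n) f = f 0 + sumBelow n (f ∘ suc)

sum-map-applyUpTo : ∀ (f g : ℕ → ℕ) n → sum (map f (applyUpTo g n)) ≡ sumBelow n (f ∘ g)
sum-map-applyUpTo f g zero    = refl
sum-map-applyUpTo f g (suc n) = cong (f (g 0) +_) (sum-map-applyUpTo f (g ∘ suc) n)

sum-map-upTo : ∀ (f : ℕ → ℕ) n → sum (map f (upTo n)) ≡ sumBelow n f
sum-map-upTo f = sum-map-applyUpTo f id

sumBelow-cong : ∀ n {f g : ℕ → ℕ} → (∀ i → i < n → f i ≡ g i) → sumBelow n f ≡ sumBelow n g
sumBelow-cong zero    _    = refl
sumBelow-cong (suc n) f≗g = cong₂ _+_ (f≗g 0 (s≤s z≤n)) (sumBelow-cong n (λ i i< → f≗g (suc i) (s≤s i<)))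

sumBelow-! : ∀ {A : Set} (f : A → ℕ) (xs : List A) {d : A} →
             sumBelow (length xs) (λ i → f (xs ! i [ d ])) ≡ sum (map f xs)
sumBelow-! f []       = refl
sumBelow-! f (x ∷ xs) = cong (f x +_) (sumBelow-! f xs)

δ : ℕ → ℕ → ℕ
δ r v = if v ≡ᵇ r then 1 else 0

δ-self : ∀ r → δ r r ≡ 1
δ-self zero    = refl
δ-self (suc r) = δ-self r

δ-≢ : ∀ {r v} → v ≢ r → δ r v ≡ 0
δ-≢ {zero}  {zero}  v≢r = ⊥-elim (v≢r refl)
δ-≢ {zero}  {suc v} _   = refl
δ-≢ {suc r} {zero}  _   = refl
δ-≢ {suc r} {suc v} v≢r = δ-≢ (v≢r ∘ cong suc)

occ : ℕ → List ℕ → ℕ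
occ r xs = sum (map (δ r) xs)

occ-++ : ∀ r xs ys → occ r (xs ++ ys) ≡ occ r xs + occ r ys
occ-++ r xs ys = trans (cong sum (map-++ (δ r) xs ys)) (sum-++ (map (δ r) xs) (map (δ r) ys))

occ-self-∷ : ∀ r xs → occ r (r ∷ xs) ≡ suc (occ r xs)
occ-self-∷ r xs = cong (_+ occ r xs) (δ-self r)

occ-replicate-self : ∀ r n → occ r (replicate n r) ≡ n
occ-replicate-self r zero    = refl
occ-replicate-self r (suc n) = trans (occ-self-∷ r (replicate n r)) (cong suc (occ-replicate-self r n))

occ-absent : ∀ {r xs} → All (_≢ r) xs → occ r xs ≡ 0
occ-absent []            = refl
occ-absent (x≢r ∷ xs≢r) = cong₂ _+_ (δ-≢ x≢r) (occ-absent xs≢r)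

occ-outside : ∀ {lo n r xs} → All (Between lo n) xs → ¬ Between lo n r → occ r xs ≡ 0
occ-outside {lo} {n} xs∈ r∉ = occ-absent (All.map (λ v∈ v≡r → r∉ (subst (Between lo n) v≡r v∈)) xs∈)

Descending : List ℕ → Set
Descending = AllPairs _≥_

Descending⇒!-antitone : ∀ {xs} → Descending xs →
                        ∀ {c c′} → c < c′ → c′ < length xs → xs !ℕ c′ ≤ xs !ℕ c
Descending⇒!-antitone (x≥ ∷ _)  {zero}  {suc c′} _           (s≤s c′<) = All⇒! x≥ c′<
Descending⇒!-antitone (_  ∷ ds) {suc c} {suc c′} (s≤s c<c′) (s≤s c′<) =
  Descending⇒!-antitone ds c<c′ c′<

!-antitone⇒Descending : ∀ xs → (∀ {c c′} → c < c′ → c′ < length xs → xs !ℕ c′ ≤ xs !ℕ c) →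
                        Descending xs
!-antitone⇒Descending []       _       = []
!-antitone⇒Descending (x ∷ xs) antitone =
  !⇒All xs (λ i i< → antitone (s≤s z≤n) (s≤s i<)) ∷
  !-antitone⇒Descending xs (λ c<c′ c′< → antitone (s≤s c<c′) (s≤s c′<))

occ-above-max : ∀ {x xs y} → All (_≤ x) xs → x < y → occ y (x ∷ xs) ≡ 0
occ-above-max xs≤x x<y = occ-absent (<⇒≢ x<y ∷ All.map (λ v≤x → <⇒≢ (≤-<-trans v≤x x<y)) xs≤x)

Descending-unique : ∀ {xs ys} → Descending xs → Descending ys → (∀ r → occ r xs ≡ occ r ys) → xs ≡ ys
Descending-unique {[]}     {[]}     _ _ _ = refl
Descending-unique {[]}     {y ∷ ys} _ _ same with () ← trans (same y) (occ-self-∷ y ys)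
Descending-unique {x ∷ xs} {[]}     _ _ same with () ← trans (sym (same x)) (occ-self-∷ x xs)
Descending-unique {x ∷ xs} {y ∷ ys} (xs≤x ∷ dxs) (ys≤y ∷ dys) same with <-cmp x y
... | tri< x<y _ _ with () ← trans (sym (occ-above-max xs≤x x<y)) (trans (same y) (occ-self-∷ y ys))
... | tri> _ _ y<x with () ← trans (sym (occ-above-max ys≤y y<x)) (trans (sym (same x)) (occ-self-∷ x xs))
... | tri≈ _ refl _ = cong (x ∷_) (Descending-unique dxs dys (λ r → +-cancelˡ-≡ (δ r x) _ _ (same r)))

stack : List ℕ → ℕ → List ℕ
stack []      lo = []
stack (x ∷ c) lo = stack c (suc lo) ++ replicate x lo

length-stack : ∀ c lo → length (stack c lo) ≡ sum c
length-stack []      lo = refl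
length-stack (x ∷ c) lo = begin
  length (stack c (suc lo) ++ replicate x lo)          ≡⟨ length-++ (stack c (suc lo)) ⟩
  length (stack c (suc lo)) + length (replicate x lo) ≡⟨ cong₂ _+_ (length-stack c (suc lo)) (length-replicate x) ⟩
  sum c + x                                            ≡⟨ +-comm (sum c) x ⟩
  x + sum c                                            ∎

stack-between : ∀ c lo → All (Between lo (length c)) (stack c lo)
stack-between []      lo = []
stack-between (x ∷ c) lo =
  All-++⁺ (All.map widen (stack-between c (suc lo)))
          (All-replicate⁺ x (≤-refl , m<m+n lo (s≤s z≤n)))
  where
  widen : ∀ {v} → Between (suc lo) (length c) v → Between lo (suc (length c)) v
  widen {v} (lo<v , v<) = <⇒≤ lo<v , subst (v <_) (sym (+-suc lo (length c))) v<

replicate-descending : ∀ n r → Descending (replicate n r)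
replicate-descending zero    r = []
replicate-descending (suc n) r = All-replicate⁺ n ≤-refl ∷ replicate-descending n r

stack-descending : ∀ c lo → Descending (stack c lo)
stack-descending []      lo = []
stack-descending (x ∷ c) lo =
  AllPairs.++⁺ (stack-descending c (suc lo)) (replicate-descending x lo)
               (All.map (λ v∈ → All-replicate⁺ x (<⇒≤ (proj₁ v∈))) (stack-between c (suc lo)))

occ-stack : ∀ c lo j → occ (lo + j) (stack c lo) ≡ c !ℕ j
occ-stack []      lo j       = refl
occ-stack (x ∷ c) lo zero    = begin
  occ (lo + 0) (stack c (suc lo) ++ replicate x lo)
    ≡⟨ cong (λ r → occ r (stack c (suc lo) ++ replicate x lo)) (+-identityʳ lo) ⟩
  occ lo (stack c (suc lo) ++ replicate x lo)
    ≡⟨ occ-++ lo (stack c (suc lo)) (replicate x lo) ⟩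
  occ lo (stack c (suc lo)) + occ lo (replicate x lo)
    ≡⟨ cong₂ _+_ (occ-outside (stack-between c (suc lo)) (n≮n lo ∘ proj₁)) (occ-replicate-self lo x) ⟩
  x
    ∎
occ-stack (x ∷ c) lo (suc j) = begin
  occ (lo + suc j) (stack c (suc lo) ++ replicate x lo)
    ≡⟨ cong (λ r → occ r (stack c (suc lo) ++ replicate x lo)) (+-suc lo j) ⟩
  occ (suc lo + j) (stack c (suc lo) ++ replicate x lo)
    ≡⟨ occ-++ (suc lo + j) (stack c (suc lo)) (replicate x lo) ⟩
  occ (suc lo + j) (stack c (suc lo)) + occ (suc lo + j) (replicate x lo)
    ≡⟨ cong₂ _+_ (occ-stack c (suc lo) j) (occ-absent (All-replicate⁺ x lo≢)) ⟩
  c !ℕ j + 0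
    ≡⟨ +-identityʳ (c !ℕ j) ⟩
  c !ℕ j
    ∎
  where
  lo≢ : lo ≢ suc lo + j
  lo≢ lo≡ = <-irrefl lo≡ (s≤s (m≤m+n lo j))

occsFrom : ℕ → ℕ → List ℕ → List ℕ
occsFrom lo zero    xs = []
occsFrom lo (suc n) xs = occ lo xs ∷ occsFrom (suc lo) n xs

length-occsFrom : ∀ lo n xs → length (occsFrom lo n xs) ≡ n
length-occsFrom lo zero    xs = refl
length-occsFrom lo (suc n) xs = cong suc (length-occsFrom (suc lo) n xs)

!-occsFrom : ∀ lo n xs {j} → j < n → occsFrom lo n xs !ℕ j ≡ occ (lo + j) xs
!-occsFrom lo (suc n) xs {zero}  _         = cong (λ r → occ r xs) (sym (+-identityʳ lo))
!-occsFrom lo (suc n) xs {suc j} (s≤s j<n) =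
  trans (!-occsFrom (suc lo) n xs j<n) (cong (λ r → occ r xs) (sym (+-suc lo j)))

occsFrom-stack : ∀ c lo → occsFrom lo (length c) (stack c lo) ≡ c
occsFrom-stack c lo = !-ext _ c (length-occsFrom lo (length c) (stack c lo)) λ j j< →
  trans (!-occsFrom lo (length c) (stack c lo) (subst (j <_) (length-occsFrom lo _ _) j<)) (occ-stack c lo j)

stack-occsFrom : ∀ {lo n xs} → Descending xs → All (Between lo n) xs → stack (occsFrom lo n xs) lo ≡ xs
stack-occsFrom {lo} {n} {xs} desc xs∈ =
  Descending-unique (stack-descending (occsFrom lo n xs) lo) desc same
  where
  stack∈ : All (Between lo n) (stack (occsFrom lo n xs) lo)
  stack∈ = subst (λ k → All (Between lo k) (stack (occsFrom lo n xs) lo)) (length-occsFrom lo n xs)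
                 (stack-between (occsFrom lo n xs) lo)
  same-at : ∀ {r} → Between lo n r → occ r (stack (occsFrom lo n xs) lo) ≡ occ r xs
  same-at r∈ with Between⇒offset r∈
  ... | j , j<n , refl = trans (occ-stack (occsFrom lo n xs) lo j) (!-occsFrom lo n xs j<n)
  same : ∀ r → occ r (stack (occsFrom lo n xs) lo) ≡ occ r xs
  same r with between? lo n r
  ... | yes r∈ = same-at r∈
  ... | no  r∉ = trans (occ-outside stack∈ r∉) (sym (occ-outside xs∈ r∉))

sum-occsFrom : ∀ {lo n xs} → Descending xs → All (Between lo n) xs → sum (occsFrom lo n xs) ≡ length xs
sum-occsFrom {lo} {n} {xs} desc xs∈ =
  trans (sym (length-stack (occsFrom lo n xs) lo)) (cong length (stack-occsFrom desc xs∈))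

-- Fundamental slide polynomials

Positive : List ℕ → Set
Positive = All (1 ≤_)

positive-flat : ∀ xs → Positive (flat xs)
positive-flat []           = []
positive-flat (zero  ∷ xs) = positive-flat xs
positive-flat (suc x ∷ xs) = s≤s z≤n ∷ positive-flat xs

sum-flat : ∀ xs → sum (flat xs) ≡ sum xs
sum-flat []           = refl
sum-flat (zero  ∷ xs) = sum-flat xs
sum-flat (suc x ∷ xs) = cong (suc x +_) (sum-flat xs)

flat-replicate-zero-++ : ∀ m xs → flat (replicate m 0 ++ xs) ≡ flat xs
flat-replicate-zero-++ zero    xs = refl
flat-replicate-zero-++ (suc m) xs = flat-replicate-zero-++ m xs

positive-sum≡0⇒[] : ∀ {xs} → Positive xs → sum xs ≡ 0 → xs ≡ []
positive-sum≡0⇒[] {[]}         _ _  = refl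
positive-sum≡0⇒[] {zero  ∷ xs} (() ∷ _)
positive-sum≡0⇒[] {suc x ∷ xs} _ ()

Refines-sum : ∀ {β γ} → Refines β γ → sum β ≡ sum γ
Refines-sum ref[]                 = refl
Refines-sum (ref∷ β₁ β₂ γ _ β₂⊑γ) = trans (sum-++ β₁ β₂) (cong (sum β₁ +_) (Refines-sum β₂⊑γ))

-- A first block starting with x and summing to y ≤ x can only be [x], as the other parts are positive.
Refines-∷⁻ : ∀ {x rest y γ} → Positive rest → y ≤ x → Refines (x ∷ rest) (y ∷ γ) →
             x ≡ y × Refines rest γ
Refines-∷⁻ pos y≤x ref = firstBlock ref refl pos y≤x
  where
  -- The index β₁ ++ β₂ of ref∷ cannot be unified with x ∷ rest directly, hence the explicit equation.
  firstBlock : ∀ {β x rest y γ} → Refines β (y ∷ γ) → β ≡ x ∷ rest → Positive rest → y ≤ x →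
               x ≡ y × Refines rest γ
  firstBlock (ref∷ []       _  _ []≢[] _)   _    _   _   = ⊥-elim ([]≢[] refl)
  firstBlock (ref∷ (w ∷ β₁) β₂ _ _     β₂⊑γ) refl pos w+Σβ₁≤w
    with positive-sum≡0⇒[] (All-++⁻ˡ β₁ pos)
           (n≤0⇒n≡0 (+-cancelˡ-≤ w _ _ (subst (w + sum β₁ ≤_) (sym (+-identityʳ w)) w+Σβ₁≤w)))
  ... | refl = sym (+-identityʳ w) , β₂⊑γ

Refines-++ : ∀ p {β γ} → Positive p → Refines β γ → Refines (p ++ β) (p ++ γ)
Refines-++ []      []        β⊑γ = β⊑γ
Refines-++ (y ∷ p) (_ ∷ pos) β⊑γ =
  subst (λ s → Refines (y ∷ p ++ _) (s ∷ p ++ _)) (+-identityʳ y)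
        (ref∷ (y ∷ []) (p ++ _) (p ++ _) (λ ()) (Refines-++ p pos β⊑γ))

Dominates-head : ∀ {x b y q} → Dominates (x ∷ b) (y ∷ q) → y ≤ x
Dominates-head {x} {b} {y} dom = subst₂ _≤_ (+-identityʳ y) (+-identityʳ x) (dom 1 (s≤s z≤n))

Dominates-∷⁻ : ∀ {x b q} → Dominates (x ∷ b) (x ∷ q) → Dominates b q
Dominates-∷⁻ {x} dom i i≤ = +-cancelˡ-≤ x _ _ (dom (suc i) (s≤s i≤))

Dominates-∷⁺ : ∀ {x b q} → Dominates b q → Dominates (x ∷ b) (x ∷ q)
Dominates-∷⁺     dom zero    _         = z≤n
Dominates-∷⁺ {x} dom (suc i) (s≤s i≤) = +-monoʳ-≤ x (dom i i≤)

InSlide-∷⁻ : ∀ {y q b} → 1 ≤ y → InSlide (y ∷ q) b → ∃[ c ] b ≡ y ∷ c × InSlide q c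
InSlide-∷⁻ {b = []}              _ (() , _)
InSlide-∷⁻ {suc y} {b = zero ∷ b} _ (_ , dom , _) with () ← Dominates-head dom
InSlide-∷⁻ {suc y} {b = suc x ∷ b} _ (len , dom , ref)
  with Refines-∷⁻ (positive-flat b) (Dominates-head dom) ref
... | refl , ref′ = b , refl , suc-injective len , Dominates-∷⁻ dom , ref′

InSlide-∷⁺ : ∀ {y q c} → 1 ≤ y → InSlide q c → InSlide (y ∷ q) (y ∷ c)
InSlide-∷⁺ {suc y} _ (len , dom , ref) =
  cong suc len , Dominates-∷⁺ dom , Refines-++ (suc y ∷ []) (s≤s z≤n ∷ []) ref

InSlide-++⁻ : ∀ {p q b} → Positive p → InSlide (p ++ q) b → ∃[ c ] b ≡ p ++ c × InSlide q c
InSlide-++⁻ []           slide = _ , refl , slide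
InSlide-++⁻ (1≤y ∷ pos) slide with InSlide-∷⁻ 1≤y slide
... | _ , refl , slide′ with InSlide-++⁻ pos slide′
...   | c , refl , slide″ = c , refl , slide″

InSlide-++⁺ : ∀ {p q c} → Positive p → InSlide q c → InSlide (p ++ q) (p ++ c)
InSlide-++⁺ []           slide = slide
InSlide-++⁺ (1≤y ∷ pos) slide = InSlide-∷⁺ 1≤y (InSlide-++⁺ pos slide)

length-replicate-zero-∷ʳ : ∀ m z → length (replicate m 0 ++ z ∷ []) ≡ suc m
length-replicate-zero-∷ʳ zero    z = refl
length-replicate-zero-∷ʳ (suc m) z = cong suc (length-replicate-zero-∷ʳ m z)

sum-replicate-zero-∷ʳ : ∀ m z → sum (replicate m 0 ++ z ∷ []) ≡ z
sum-replicate-zero-∷ʳ zero    z = +-identityʳ z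
sum-replicate-zero-∷ʳ (suc m) z = sum-replicate-zero-∷ʳ m z

sum-take-replicate-zero : ∀ m xs {i} → i ≤ m → sum (take i (replicate m 0 ++ xs)) ≡ 0
sum-take-replicate-zero m       xs {zero}  _         = refl
sum-take-replicate-zero (suc m) xs {suc i} (s≤s i≤m) = sum-take-replicate-zero m xs i≤m

InSlide-replicate-zero-∷ʳ⁻ : ∀ {m z c} → InSlide (replicate m 0 ++ z ∷ []) c → length c ≡ suc m × sum c ≡ z
InSlide-replicate-zero-∷ʳ⁻ {m} {z} {c} (len , _ , ref) = trans len (length-replicate-zero-∷ʳ m z) , (begin
  sum c                                 ≡⟨ sum-flat c ⟨
  sum (flat c)                          ≡⟨ Refines-sum ref ⟩
  sum (flat (replicate m 0 ++ z ∷ []))  ≡⟨ sum-flat (replicate m 0 ++ z ∷ []) ⟩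
  sum (replicate m 0 ++ z ∷ [])         ≡⟨ sum-replicate-zero-∷ʳ m z ⟩
  z                                     ∎)

InSlide-replicate-zero-∷ʳ⁺ : ∀ {m z c} → length c ≡ suc m → sum c ≡ z → InSlide (replicate m 0 ++ z ∷ []) c
InSlide-replicate-zero-∷ʳ⁺ {m} {z} {c} len Σc = trans len (sym (length-replicate-zero-∷ʳ m z)) , dom , ref z Σc
  where
  q : List ℕ
  q = replicate m 0 ++ z ∷ []
  dom : Dominates c q
  dom i i≤ with m≤n⇒m<n∨m≡n (subst (i ≤_) (length-replicate-zero-∷ʳ m z) i≤)
  ... | inj₁ (s≤s i≤m) = subst (_≤ sum (take i c)) (sym (sum-take-replicate-zero m (z ∷ []) i≤m)) z≤n
  ... | inj₂ refl      = ≤-reflexive (begin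
    sum (take (suc m) q) ≡⟨ cong sum (take-all (suc m) q (≤-reflexive (length-replicate-zero-∷ʳ m z))) ⟩
    sum q                ≡⟨ sum-replicate-zero-∷ʳ m z ⟩
    z                    ≡⟨ Σc ⟨
    sum c                ≡⟨ cong sum (take-all (suc m) c (≤-reflexive len)) ⟨
    sum (take (suc m) c) ∎)
  ref : ∀ z → sum c ≡ z → Refines (flat c) (flat (replicate m 0 ++ z ∷ []))
  ref zero Σc rewrite flat-replicate-zero-++ m (zero ∷ [])
    | positive-sum≡0⇒[] (positive-flat c) (trans (sum-flat c) Σc) = ref[]
  ref (suc z) Σc rewrite flat-replicate-zero-++ m (suc z ∷ []) =
    subst₂ Refines (++-identityʳ (flat c)) (cong (_∷ []) (trans (sum-flat c) Σc))
           (ref∷ (flat c) [] [] flat≢[] ref[])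
    where
    flat≢[] : flat c ≢ []
    flat≢[] flat≡[] with () ← trans (sym Σc) (trans (sym (sum-flat c)) (cong sum flat≡[]))

-- Kohnert tableaux

rowCount-occ : ∀ T r → rowCount (map length T) T r ≡ sum (map (occ r) T)
rowCount-occ T r = begin
  rowCount (map length T) T r
    ≡⟨ sum-map-upTo _ (length (map length T)) ⟩
  sumBelow (length (map length T)) (λ i → sum (map (λ c → δ r (rowOf T i c)) (upTo (map length T !ℕ i))))
    ≡⟨ sumBelow-cong (length (map length T)) (λ i _ → rowᵢ i) ⟩
  sumBelow (length (map length T)) (λ i → occ r (T ! i [ [] ]))
    ≡⟨ cong (λ n → sumBelow n (λ i → occ r (T ! i [ [] ]))) (length-map length T) ⟩
  sumBelow (length T) (λ i → occ r (T ! i [ [] ]))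
    ≡⟨ sumBelow-! (occ r) T ⟩
  sum (map (occ r) T)
    ∎
  where
  rowᵢ : ∀ i → sum (map (λ c → δ r (rowOf T i c)) (upTo (map length T !ℕ i))) ≡ occ r (T ! i [ [] ])
  rowᵢ i = begin
    sum (map (λ c → δ r (rowOf T i c)) (upTo (map length T !ℕ i)))
      ≡⟨ sum-map-upTo _ (map length T !ℕ i) ⟩
    sumBelow (map length T !ℕ i) (λ c → δ r (rowOf T i c))
      ≡⟨ cong (λ n → sumBelow n (λ c → δ r (rowOf T i c))) (!-map length T i) ⟩
    sumBelow (length (T ! i [ [] ])) (λ c → δ r (rowOf T i c))
      ≡⟨ sumBelow-! (δ r) (T ! i [ [] ]) ⟩
    occ r (T ! i [ [] ])
      ∎

rowsFrom : List ℕ → ℕ → List (List ℕ)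
rowsFrom []       s = []
rowsFrom (x ∷ xs) s = replicate x s ∷ rowsFrom xs (suc s)

lengths-rowsFrom : ∀ xs s → map length (rowsFrom xs s) ≡ xs
lengths-rowsFrom []       s = refl
lengths-rowsFrom (x ∷ xs) s = cong₂ _∷_ (length-replicate x) (lengths-rowsFrom xs (suc s))

length-rowsFrom : ∀ xs s → length (rowsFrom xs s) ≡ length xs
length-rowsFrom xs s = trans (sym (length-map length (rowsFrom xs s))) (cong length (lengths-rowsFrom xs s))

!-rowsFrom : ∀ xs s {i} → i < length xs → rowsFrom xs s ! i [ [] ] ≡ replicate (xs !ℕ i) (s + i)
!-rowsFrom (x ∷ xs) s {zero}  _         = cong (replicate x) (sym (+-identityʳ s))
!-rowsFrom (x ∷ xs) s {suc i} (s≤s i<n) =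
  trans (!-rowsFrom xs (suc s) i<n) (cong (replicate (xs !ℕ i)) (sym (+-suc s i)))

occ-rowsFrom-below : ∀ xs {s r} → r < s → sum (map (occ r) (rowsFrom xs s)) ≡ 0
occ-rowsFrom-below []       r<s = refl
occ-rowsFrom-below (x ∷ xs) r<s =
  cong₂ _+_ (occ-absent (All-replicate⁺ x (λ s≡r → <-irrefl (sym s≡r) r<s))) (occ-rowsFrom-below xs (m<n⇒m<1+n r<s))

occ-rowsFrom : ∀ xs s r → sum (map (occ (s + r)) (rowsFrom xs s)) ≡ xs !ℕ r
occ-rowsFrom []       s r       = refl
occ-rowsFrom (x ∷ xs) s zero    rewrite +-identityʳ s =
  trans (cong₂ _+_ (occ-replicate-self s x) (occ-rowsFrom-below xs (n<1+n s))) (+-identityʳ x)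
occ-rowsFrom (x ∷ xs) s (suc r) rewrite +-suc s r =
  cong₂ _+_ (occ-absent (All-replicate⁺ x (λ s≡ → <-irrefl s≡ (s≤s (m≤m+n s r))))) (occ-rowsFrom xs (suc s) r)

shape-from-lengths : ∀ {a : List ℕ} {T : List (List ℕ)} → map length T ≡ a →
                     length T ≡ length a × (∀ i → length (T ! i [ [] ]) ≡ a !ℕ i)
shape-from-lengths {T = T} refl = sym (length-map length T) , λ i → sym (!-map length T i)

occ-replicate-[]-∷ʳ : ∀ m r L → sum (map (occ r) (replicate m [] ++ L ∷ [])) ≡ occ r L
occ-replicate-[]-∷ʳ zero    r L = +-identityʳ (occ r L)
occ-replicate-[]-∷ʳ (suc m) r L = occ-replicate-[]-∷ʳ m r L

module Tableaux (as : List ℕ) (m z : ℕ) where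

  N : ℕ
  N = length as

  a : List ℕ
  a = as ++ replicate m 0 ++ z ∷ []

  length-a : length a ≡ N + suc m
  length-a = trans (length-++ as) (cong (N +_) (length-replicate-zero-∷ʳ m z))

  data Position (i : ℕ) : Set where
    inPrefix : i < N → Position i
    inZeros  : ∀ {j} → j < m → i ≡ N + j → Position i
    atEnd    : i ≡ N + m → Position i

  position : ∀ {i} → i < length a → Position i
  position {i} i< with index-split N (subst (i <_) length-a i<)
  ... | inj₁ i<N = inPrefix i<N
  ... | inj₂ (j , s≤s j≤m , i≡) with m≤n⇒m<n∨m≡n j≤m
  ...   | inj₁ j<m  = inZeros j<m i≡
  ...   | inj₂ refl = atEnd i≡

  a-prefix : ∀ {i} → i < N → a !ℕ i ≡ as !ℕ i
  a-prefix = !-++ˡ as _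

  a-zeros : ∀ {j} → j < m → a !ℕ (N + j) ≡ 0
  a-zeros j<m = trans (!-++ʳ as _ refl) (!-replicate-++ m 0 _ j<m)

  a-end : a !ℕ (N + m) ≡ z
  a-end = trans (!-++ʳ as _ refl) (!-replicate-++-end m 0 (z ∷ []))

  data CellPosition (i c : ℕ) : Set where
    prefixCell : i < N → c < as !ℕ i → CellPosition i c
    endCell    : i ≡ N + m → c < z → CellPosition i c

  cellPosition : ∀ {i c} → IsCell a i c → CellPosition i c
  cellPosition {i} {c} (i< , c<) with position i<
  ... | inPrefix i<N      = prefixCell i<N (subst (c <_) (a-prefix i<N) c<)
  ... | inZeros j<m refl with () ← subst (c <_) (a-zeros j<m) c<
  ... | atEnd refl        = endCell refl (subst (c <_) a-end c<)

  ≤end : ∀ {i} → i < length a → i ≤ N + m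
  ≤end {i} i< = ≤-pred (subst (i <_) (trans length-a (+-suc N m)) i<)

  prefix<length : ∀ {i} → i < N → i < length a
  prefix<length i<N = <-≤-trans i<N (subst (N ≤_) (sym length-a) (m≤m+n N (suc m)))

  end<length : N + m < length a
  end<length = subst (N + m <_) (sym length-a) (+-monoʳ-< N ≤-refl)

  isCell-prefix : ∀ {i c} → i < N → c < as !ℕ i → IsCell a i c
  isCell-prefix {i} {c} i<N c< = prefix<length i<N , subst (c <_) (sym (a-prefix i<N)) c<

  isCell-end : ∀ {c} → c < z → IsCell a (N + m) c
  isCell-end {c} c<z = end<length , subst (c <_) (sym a-end) c<z

  tableauOf : List ℕ → List (List ℕ)
  tableauOf L = rowsFrom as 1 ++ replicate m [] ++ L ∷ []

  lengths-tableauOf : ∀ {L} → length L ≡ z → map length (tableauOf L) ≡ a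
  lengths-tableauOf {L} len = begin
    map length (rowsFrom as 1 ++ replicate m [] ++ L ∷ [])
      ≡⟨ map-++ length (rowsFrom as 1) _ ⟩
    map length (rowsFrom as 1) ++ map length (replicate m [] ++ L ∷ [])
      ≡⟨ cong₂ _++_ (lengths-rowsFrom as 1) (map-++ length (replicate m []) _) ⟩
    as ++ map length (replicate m []) ++ length L ∷ []
      ≡⟨ cong₂ (λ zs l → as ++ zs ++ l ∷ []) (map-replicate length m []) len ⟩
    a ∎

  tableauOf-prefix : ∀ {L i} → i < N → tableauOf L ! i [ [] ] ≡ replicate (as !ℕ i) (suc i)
  tableauOf-prefix {i = i} i<N =
    trans (!-++ˡ (rowsFrom as 1) _ (subst (i <_) (sym (length-rowsFrom as 1)) i<N)) (!-rowsFrom as 1 i<N)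

  tableauOf-zeros : ∀ {L j} → j < m → tableauOf L ! (N + j) [ [] ] ≡ []
  tableauOf-zeros j<m = trans (!-++ʳ (rowsFrom as 1) _ (length-rowsFrom as 1)) (!-replicate-++ m [] _ j<m)

  tableauOf-end : ∀ {L} → tableauOf L ! (N + m) [ [] ] ≡ L
  tableauOf-end {L} = trans (!-++ʳ (rowsFrom as 1) _ (length-rowsFrom as 1)) (!-replicate-++-end m [] (L ∷ []))

  rowOf-prefix : ∀ {L i c} → i < N → c < as !ℕ i → rowOf (tableauOf L) i c ≡ suc i
  rowOf-prefix {L} {i} {c} i<N c< = trans (cong (_!ℕ c) (tableauOf-prefix i<N)) (!-replicate (as !ℕ i) (suc i) c<)

  rowOf-end : ∀ {L c} → rowOf (tableauOf L) (N + m) c ≡ L !ℕ c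
  rowOf-end {L} {c} = cong (_!ℕ c) tableauOf-end

  -- The rows, column by column, of the cells of the last entry of a Kohnert tableau of content a.
  record IsProfile (L : List ℕ) : Set where
    field
      length≡z   : length L ≡ z
      descending : Descending L
      between    : All (Between (suc N) (suc m)) L

  weight : List ℕ → List ℕ
  weight L = as ++ occsFrom (suc N) (suc m) L

  length-weight : ∀ L → length (weight L) ≡ length a
  length-weight L = trans (length-++ as) (trans (cong (N +_) (length-occsFrom (suc N) (suc m) L)) (sym length-a))

  module _ {L} (P : IsProfile L) where
    open IsProfile P

    endRow-between : ∀ {c} → c < z → Between (suc N) (suc m) (rowOf (tableauOf L) (N + m) c)
    endRow-between {c} c<z =
      subst (Between (suc N) (suc m)) (sym rowOf-end) (All⇒! between (subst (c <_) (sym length≡z) c<z))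

    prefixRow<endRow : ∀ {i c c′} → i < N → c < as !ℕ i → c′ < z →
                       rowOf (tableauOf L) i c < rowOf (tableauOf L) (N + m) c′
    prefixRow<endRow i<N c< c′<z =
      subst (_< _) (sym (rowOf-prefix i<N c<)) (<-≤-trans (s≤s i<N) (proj₁ (endRow-between c′<z)))

    tableauOf-isKohnert : IsKohnertTableau a (tableauOf L)
    tableauOf-isKohnert = record
      { shapeLen = proj₁ shape
      ; shapeRow = λ i _ → proj₂ shape i
      ; rowPos   = rowPos
      ; distinct = distinct
      ; condII   = condII
      ; condIII  = condIII
      ; condIV   = condIV
      }
      where
      T : List (List ℕ)
      T = tableauOf L
      shape : length T ≡ length a × (∀ i → length (T ! i [ [] ]) ≡ a !ℕ i)
      shape = shape-from-lengths (lengths-tableauOf length≡z)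

      rowPos : ∀ i c → IsCell a i c → 1 ≤ rowOf T i c
      rowPos i c ic with cellPosition ic
      ... | prefixCell i<N c< = subst (1 ≤_) (sym (rowOf-prefix i<N c<)) (s≤s z≤n)
      ... | endCell refl c<z  = ≤-trans (s≤s z≤n) (proj₁ (endRow-between c<z))

      distinct : ∀ i j c → IsCell a i c → IsCell a j c → i ≢ j → rowOf T i c ≢ rowOf T j c
      distinct i j c ic jc i≢j with cellPosition ic | cellPosition jc
      ... | prefixCell i<N cᵢ | prefixCell j<N cⱼ = λ rᵢ≡rⱼ →
        i≢j (suc-injective (trans (sym (rowOf-prefix i<N cᵢ)) (trans rᵢ≡rⱼ (rowOf-prefix j<N cⱼ))))
      ... | prefixCell i<N cᵢ | endCell refl cⱼ  = <⇒≢ (prefixRow<endRow i<N cᵢ cⱼ)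
      ... | endCell refl cᵢ  | prefixCell j<N cⱼ = <⇒≢ (prefixRow<endRow j<N cⱼ cᵢ) ∘ sym
      ... | endCell i≡ _     | endCell j≡ _      = λ _ → i≢j (trans i≡ (sym j≡))

      condII : ∀ i c → IsCell a i c → rowOf T i c ≤ suc i
      condII i c ic with cellPosition ic
      ... | prefixCell i<N c< = ≤-reflexive (rowOf-prefix i<N c<)
      ... | endCell refl c<z  =
        subst (rowOf T (N + m) c ≤_) (+-suc N m) (≤-pred (proj₂ (endRow-between c<z)))

      condIII : ∀ i c c′ → IsCell a i c′ → c < c′ → rowOf T i c′ ≤ rowOf T i c
      condIII i c c′ ic′ c<c′ with cellPosition ic′
      ... | prefixCell i<N c′< =
        ≤-reflexive (trans (rowOf-prefix i<N c′<) (sym (rowOf-prefix i<N (<-trans c<c′ c′<))))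
      ... | endCell refl c′<z  = subst₂ _≤_ (sym rowOf-end) (sym rowOf-end)
        (Descending⇒!-antitone descending c<c′ (subst (c′ <_) (sym length≡z) c′<z))

      condIV : ∀ i j c → IsCell a i c → IsCell a j c → i < j → rowOf T j c < rowOf T i c →
               suc c < a !ℕ i × rowOf T j c < rowOf T i (suc c)
      condIV i j c ic jc i<j rⱼ<rᵢ with cellPosition ic | cellPosition jc
      ... | prefixCell i<N cᵢ | prefixCell j<N cⱼ =
        ⊥-elim (<-asym i<j (≤-pred (subst₂ _<_ (rowOf-prefix j<N cⱼ) (rowOf-prefix i<N cᵢ) rⱼ<rᵢ)))
      ... | prefixCell i<N cᵢ | endCell refl cⱼ = ⊥-elim (<-asym rⱼ<rᵢ (prefixRow<endRow i<N cᵢ cⱼ))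
      ... | endCell refl _    | _               = ⊥-elim (≤⇒≯ (≤end (proj₁ jc)) i<j)

    rowCount-tableauOf : ∀ r → rowCount a (tableauOf L) (suc r) ≡ as !ℕ r + occ (suc r) L
    rowCount-tableauOf r = begin
      rowCount a (tableauOf L) (suc r)
        ≡⟨ cong (λ a′ → rowCount a′ (tableauOf L) (suc r)) (sym (lengths-tableauOf length≡z)) ⟩
      rowCount (map length (tableauOf L)) (tableauOf L) (suc r)
        ≡⟨ rowCount-occ (tableauOf L) (suc r) ⟩
      sum (map (occ (suc r)) (rowsFrom as 1 ++ replicate m [] ++ L ∷ []))
        ≡⟨ cong sum (map-++ (occ (suc r)) (rowsFrom as 1) _) ⟩
      sum (map (occ (suc r)) (rowsFrom as 1) ++ map (occ (suc r)) (replicate m [] ++ L ∷ []))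
        ≡⟨ sum-++ (map (occ (suc r)) (rowsFrom as 1)) _ ⟩
      sum (map (occ (suc r)) (rowsFrom as 1)) + sum (map (occ (suc r)) (replicate m [] ++ L ∷ []))
        ≡⟨ cong₂ _+_ (occ-rowsFrom as 1 r) (occ-replicate-[]-∷ʳ m (suc r) L) ⟩
      as !ℕ r + occ (suc r) L
        ∎

    !-weight : ∀ {r} → r < length a → weight L !ℕ r ≡ as !ℕ r + occ (suc r) L
    !-weight {r} r< with index-split N (subst (r <_) length-a r<)
    ... | inj₁ r<N = begin
      weight L !ℕ r            ≡⟨ !-++ˡ as _ r<N ⟩
      as !ℕ r                  ≡⟨ +-identityʳ (as !ℕ r) ⟨
      as !ℕ r + 0              ≡⟨ cong (as !ℕ r +_) (occ-outside between (<⇒≱ r<N ∘ ≤-pred ∘ proj₁)) ⟨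
      as !ℕ r + occ (suc r) L  ∎
    ... | inj₂ (j , j<1+m , refl) = begin
      weight L !ℕ (N + j)                   ≡⟨ !-++ʳ as _ refl ⟩
      occsFrom (suc N) (suc m) L !ℕ j       ≡⟨ !-occsFrom (suc N) (suc m) L j<1+m ⟩
      occ (suc N + j) L                     ≡⟨ cong (_+ occ (suc N + j) L) (!-beyond as (m≤m+n N j)) ⟨
      as !ℕ (N + j) + occ (suc N + j) L     ∎

    kohnertOfWeight⇒≡weight : ∀ {b} → KohnertOfWeight a b (tableauOf L) → b ≡ weight L
    kohnertOfWeight⇒≡weight {b} kw = !-ext b (weight L) (trans wtLen (sym (length-weight L))) λ r r< →
      let r<ℓ = subst (r <_) wtLen r< in
      trans (wtRows r r<ℓ) (trans (rowCount-tableauOf r) (sym (!-weight r<ℓ)))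
      where open KohnertOfWeight kw

    kohnertOfWeight-weight : KohnertOfWeight a (weight L) (tableauOf L)
    kohnertOfWeight-weight = record
      { isKT   = tableauOf-isKohnert
      ; wtLen  = length-weight L
      ; wtRows = λ r r< → trans (!-weight r<) (sym (rowCount-tableauOf r))
      }

  weight-injective : ∀ {L L′} → IsProfile L → IsProfile L′ → weight L ≡ weight L′ → L ≡ L′
  weight-injective {L} {L′} P P′ weight≡ = begin
    L                                           ≡⟨ stack-occsFrom (descending P) (between P) ⟨
    stack (occsFrom (suc N) (suc m) L) (suc N)  ≡⟨ cong (λ c → stack c (suc N)) (++-cancelˡ as _ _ weight≡) ⟩
    stack (occsFrom (suc N) (suc m) L′) (suc N) ≡⟨ stack-occsFrom (descending P′) (between P′) ⟩
    L′                                          ∎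
    where open IsProfile

  stack-isProfile : ∀ c → length c ≡ suc m → sum c ≡ z → IsProfile (stack c (suc N))
  stack-isProfile c len Σc = record
    { length≡z   = trans (length-stack c (suc N)) Σc
    ; descending = stack-descending c (suc N)
    ; between    = subst (λ n → All (Between (suc N) n) (stack c (suc N))) len (stack-between c (suc N))
    }

  weight-stack : ∀ c → length c ≡ suc m → weight (stack c (suc N)) ≡ as ++ c
  weight-stack c len =
    cong (as ++_) (subst (λ n → occsFrom (suc N) n (stack c (suc N)) ≡ c) len (occsFrom-stack c (suc N)))

  slide⇒kohnert : Positive as → ∀ {b} → InSlide a b → ∃ (KohnertOfWeight a b)
  slide⇒kohnert pos slide with InSlide-++⁻ pos slide
  ... | c , refl , slide′ with InSlide-replicate-zero-∷ʳ⁻ slide′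
  ...   | len , Σc = tableauOf (stack c (suc N)) ,
                     subst (λ b → KohnertOfWeight a b (tableauOf (stack c (suc N)))) (weight-stack c len)
                           (kohnertOfWeight-weight (stack-isProfile c len Σc))

  module Rigid (wd : WeaklyDecreasing as) (z≤ : ∀ {j} → j < N → z ≤ as !ℕ j) where

    module _ {T} (kt : IsKohnertTableau a T) where
      open IsKohnertTableau kt

      row-above : ∀ {n i c} → IsCell a i c → n ≤ i → (∀ {j} → j < n → IsCell a j c × rowOf T j c ≡ suc j) →
                  n < rowOf T i c
      row-above {n} {i} {c} ic n≤i below = avoiding⇒> n (rowPos i c ic) λ {j} j<n rᵢ≡1+j →
        distinct i j c ic (proj₁ (below j<n)) (λ i≡j → <-irrefl (sym i≡j) (<-≤-trans j<n n≤i))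
                 (trans rᵢ≡1+j (sym (proj₂ (below j<n))))

      -- The entries j < i already fill rows 1, …, i of column c, as a is decreasing on its prefix,
      -- and (ii) caps entry i at row i + 1.
      prefix-rows : ∀ i {c} → i < N → c < as !ℕ i → rowOf T i c ≡ suc i
      prefix-rows = <-rec Rows step
        where
        Rows : ℕ → Set
        Rows i = ∀ {c} → i < N → c < as !ℕ i → rowOf T i c ≡ suc i
        step : ∀ i → (∀ {j} → j < i → Rows j) → Rows i
        step i rec {c} i<N c< =
          ≤-antisym (condII i c (isCell-prefix i<N c<)) (row-above (isCell-prefix i<N c<) ≤-refl below)
          where
          below : ∀ {j} → j < i → IsCell a j c × rowOf T j c ≡ suc j
          below {j} j<i = isCell-prefix j<N c<aⱼ , rec j<i j<N c<aⱼ
            where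
            j<N : j < N
            j<N = <-trans j<i i<N
            c<aⱼ : c < as !ℕ j
            c<aⱼ = <-≤-trans c< (wd j i (<⇒≤ j<i) i<N)

      end-between : ∀ {c} → c < z → Between (suc N) (suc m) (rowOf T (N + m) c)
      end-between {c} c<z =
        row-above (isCell-end c<z) (m≤m+n N m)
                  (λ j<N → isCell-prefix j<N (c<aⱼ j<N) , prefix-rows _ j<N (c<aⱼ j<N)) ,
        s≤s (subst (rowOf T (N + m) c ≤_) (sym (+-suc N m)) (condII (N + m) c (isCell-end c<z)))
        where
        c<aⱼ : ∀ {j} → j < N → c < as !ℕ j
        c<aⱼ j<N = <-≤-trans c<z (z≤ j<N)

      kohnert⇒profile : ∃[ L ] IsProfile L × T ≡ tableauOf L
      kohnert⇒profile = L , P , !-ext T (tableauOf L) length≡ sameRow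
        where
        L : List ℕ
        L = T ! (N + m) [ [] ]
        L≡z : length L ≡ z
        L≡z = trans (shapeRow (N + m) end<length) a-end
        P : IsProfile L
        P = record
          { length≡z   = L≡z
          ; descending = !-antitone⇒Descending L λ c<c′ c′< →
                           condIII (N + m) _ _ (isCell-end (subst (_ <_) L≡z c′<)) c<c′
          ; between    = !⇒All L λ c c< → end-between (subst (c <_) L≡z c<)
          }
        length≡ : length T ≡ length (tableauOf L)
        length≡ = trans shapeLen (sym (proj₁ (shape-from-lengths (lengths-tableauOf L≡z))))
        prefixRow : ∀ {i} → i < N → T ! i [ [] ] ≡ replicate (as !ℕ i) (suc i)
        prefixRow {i} i<N = !-ext _ _ (trans rowLength (sym (length-replicate (as !ℕ i)))) λ c c< →
          let c<aᵢ = subst (c <_) rowLength c< in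
          trans (prefix-rows i i<N c<aᵢ) (sym (!-replicate (as !ℕ i) (suc i) c<aᵢ))
          where
          rowLength : length (T ! i [ [] ]) ≡ as !ℕ i
          rowLength = trans (shapeRow i (prefix<length i<N)) (a-prefix i<N)
        sameRow : ∀ i → i < length T → T ! i [ [] ] ≡ tableauOf L ! i [ [] ]
        sameRow i i< with subst (i <_) shapeLen i<
        ... | i<ℓ with position i<ℓ
        ...   | inPrefix i<N     = trans (prefixRow i<N) (sym (tableauOf-prefix i<N))
        ...   | inZeros j<m refl =
          trans (length≡0⇒≡[] (trans (shapeRow _ i<ℓ) (a-zeros j<m))) (sym (tableauOf-zeros j<m))
        ...   | atEnd refl       = sym tableauOf-end

    kohnertOfWeight⇒profile : ∀ {b T} → KohnertOfWeight a b T →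
                              ∃[ L ] IsProfile L × T ≡ tableauOf L × b ≡ weight L
    kohnertOfWeight⇒profile kw with kohnert⇒profile (KohnertOfWeight.isKT kw)
    ... | L , P , refl = L , P , refl , kohnertOfWeight⇒≡weight P kw

    kohnertOfWeight-unique : ∀ {b T T′} → KohnertOfWeight a b T → KohnertOfWeight a b T′ → T ≡ T′
    kohnertOfWeight-unique kw kw′
      with kohnertOfWeight⇒profile kw | kohnertOfWeight⇒profile kw′
    ... | L , P , refl , refl | L′ , P′ , refl , weight≡ = cong tableauOf (weight-injective P P′ weight≡)

    kohnert⇒slide : Positive as → ∀ {b} → ∃ (KohnertOfWeight a b) → InSlide a b
    kohnert⇒slide pos (_ , kw) with kohnertOfWeight⇒profile kw
    ... | L , P , refl , refl = InSlide-++⁺ pos (InSlide-replicate-zero-∷ʳ⁺ (length-occsFrom (suc N) (suc m) L)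
                                  (trans (sum-occsFrom descending between) length≡z))
      where open IsProfile P

lemma3p1 : (k m : ℕ) (as : List ℕ) (z : ℕ) →
           length as ≡ suc k → AllPos as → WeaklyDecreasing as →
           z ≤ as !ℕ k →
           let a = as ++ replicate m 0 ++ (z ∷ []) in
           (b : List ℕ) →
           ((T T′ : List (List ℕ)) → KohnertOfWeight a b T → KohnertOfWeight a b T′ → T ≡ T′)
           × (InSlide a b ⇔ ∃ (λ T → KohnertOfWeight a b T))
lemma3p1 k m as z length≡ allPos wd z≤aₖ b =
  (λ _ _ → kohnertOfWeight-unique) , mk⇔ (slide⇒kohnert positive) (kohnert⇒slide positive)
  where
  open Tableaux as m z
  positive : Positive as
  positive = !⇒All as allPos
  z≤ : ∀ {j} → j < N → z ≤ as !ℕ j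
  z≤ {j} j<N = ≤-trans z≤aₖ (wd j k (≤-pred (subst (j <_) length≡ j<N)) (subst (k <_) (sym length≡) ≤-refl))
  open Rigid wd z≤
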